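{- For every continuation $K$ and every base computation $C$, $\underline{K}[\overline{C}]=\overline{C[k:=K]}$.
   Context: Syntax. Fix a ring of scalars; $\alpha$ ranges over it. Terms: $M,N ::= V \mid MN \mid \alpha.M \mid M+N$; values $V,W ::= B \mid 0 \mid \alpha.V \mid V+W$; base values $B ::= x \mid \lambda x.M$. Terms are taken up to $\alpha$-conversion and $M[x:=N]$ is capture-avoiding substitution. CPS grammar. Base computations $C ::= KB \mid BSK \mid TK$; computation combinations $D ::= C \mid 0 \mid \alpha.D \mid D_1+D_2$; base suspensions $S ::= x \mid \lambda k.C$; suspension combinations $T ::= S \mid 0 \mid \alpha.T \mid T_1+T_2$; continuations $K ::= k \mid \lambda b.bSK$; CPS-values $B ::= \lambda x.S$. Here $x$ ranges over ordinary variables, $k,b$ are reserved variables; $k$ occurs only as the continuation $k$ and as the binder in $\lambda k.C$; $b$ occurs only where displayed. Inverse translation: $\overline{KB}=\underline{K}[\phi(B)]$; $\overline{BSK}=\underline{K}[\phi(B)\sigma(S)]$; $\overline{TK}=\underline{K}[\sigma(T)]$; $\overline{0}=0$; $\overline{\alpha.D}=\alpha.\overline{D}$; $\overline{D_1+D_2}=\overline{D_1}+\overline{D_2}$; $\sigma(x)=x$; $\sigma(\lambda k.C)=\overline{C}$; $\sigma(0)=0$; $\sigma(\alpha.T)=\alpha.\sigma(T)$; $\sigma(T_1+T_2)=\sigma(T_1)+\sigma(T_2)$; $\phi(\lambda x.S)=\lambda x.\sigma(S)$; for a term $M$: $\underline{k}[M]=M$; $\underline{\lambda b.bSK}[M]=\underline{K}[M\,\sigma(S)]$.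 -}

module Defs where

open import Level using (Level)
open import Data.Nat using (ℕ; zero; suc)

-- Ordinary variables x are de Bruijn indices (ℕ); terms are therefore
-- identified up to α-conversion by construction.  The reserved variables
-- k and b are not part of the x-index space: there is a single reserved
-- name k (an occurrence of k refers to the innermost enclosing λk), and
-- b only occurs in the fixed pattern λb.bSK, so it is left implicit.

private variable a : Level

data Term (A : Set a) : Set a where
  var  : ℕ → Term A
  lam  : Term A → Term A
  app  : Term A → Term A → Term A
  zer  : Term A
  smul : A → Term A → Term A
  add  : Term A → Term A → Term A

mutual
  data BComp (A : Set a) : Set a where
    kB  : Cont A → CVal A → BComp A
    bSK : CVal A → Susp A → Cont A → BComp A
    tK  : SComb A → Cont A → BComp A

  data Comb (A : Set a) : Set a where
    cmp  : BComp A → Comb A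
    zer  : Comb A
    smul : A → Comb A → Comb A
    add  : Comb A → Comb A → Comb A

  data Susp (A : Set a) : Set a where
    var  : ℕ → Susp A
    lamk : BComp A → Susp A

  data SComb (A : Set a) : Set a where
    sus  : Susp A → SComb A
    zer  : SComb A
    smul : A → SComb A → SComb A
    add  : SComb A → SComb A → SComb A

  data Cont (A : Set a) : Set a where
    k    : Cont A
    lamb : Susp A → Cont A → Cont A     -- lamb S K  represents  λb.b S K

  data CVal (A : Set a) : Set a where
    lamx : Susp A → CVal A

ext : (ℕ → ℕ) → ℕ → ℕ
ext ρ zero    = zero
ext ρ (suc n) = suc (ρ n)

module _ {A : Set a} where
  mutual
    renC : (ℕ → ℕ) → BComp A → BComp A
    renC ρ (kB K B)    = kB (renK ρ K) (renB ρ B)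
    renC ρ (bSK B S K) = bSK (renB ρ B) (renS ρ S) (renK ρ K)
    renC ρ (tK T K)    = tK (renT ρ T) (renK ρ K)

    renS : (ℕ → ℕ) → Susp A → Susp A
    renS ρ (var n)  = var (ρ n)
    renS ρ (lamk C) = lamk (renC ρ C)

    renT : (ℕ → ℕ) → SComb A → SComb A
    renT ρ (sus S)    = sus (renS ρ S)
    renT ρ zer        = zer
    renT ρ (smul α T) = smul α (renT ρ T)
    renT ρ (add T U)  = add (renT ρ T) (renT ρ U)

    renK : (ℕ → ℕ) → Cont A → Cont A
    renK ρ k          = k
    renK ρ (lamb S K) = lamb (renS ρ S) (renK ρ K)

    renB : (ℕ → ℕ) → CVal A → CVal A
    renB ρ (lamx S) = lamx (renS (ext ρ) S)

  -- Capture-avoiding substitution  _[k:=K]  (K is shifted under λx;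
  -- λk shadows k, so substitution stops there)

  mutual
    substC : BComp A → Cont A → BComp A
    substC (kB K' B)    K = kB (substK K' K) (substB B K)
    substC (bSK B S K') K = bSK (substB B K) (substS S K) (substK K' K)
    substC (tK T K')    K = tK (substT T K) (substK K' K)

    substS : Susp A → Cont A → Susp A
    substS (var n)  K = var n
    substS (lamk C) K = lamk C

    substT : SComb A → Cont A → SComb A
    substT (sus S)    K = sus (substS S K)
    substT zer        K = zer
    substT (smul α T) K = smul α (substT T K)
    substT (add T U)  K = add (substT T K) (substT U K)

    substK : Cont A → Cont A → Cont A
    substK k           K = K
    substK (lamb S K') K = lamb (substS S K) (substK K' K)

    substB : CVal A → Cont A → CVal A
    substB (lamx S) K = lamx (substS S (renK suc K))

  mutual
    invC : BComp A → Term A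
    invC (kB K B)    = plug K (phi B)
    invC (bSK B S K) = plug K (app (phi B) (sigma S))
    invC (tK T K)    = plug K (sigmaT T)

    invD : Comb A → Term A
    invD (cmp C)    = invC C
    invD zer        = zer
    invD (smul α D) = smul α (invD D)
    invD (add D E)  = add (invD D) (invD E)

    sigma : Susp A → Term A
    sigma (var x)  = var x
    sigma (lamk C) = invC C

    sigmaT : SComb A → Term A
    sigmaT (sus S)    = sigma S
    sigmaT zer        = zer
    sigmaT (smul α T) = smul α (sigmaT T)
    sigmaT (add T U)  = add (sigmaT T) (sigmaT U)

    phi : CVal A → Term A
    phi (lamx S) = lam (sigma S)

    plug : Cont A → Term A → Term A
    plug k          M = M
    plug (lamb S K) M = plug K (app M (sigma S))

module Submission where

-- Two observations make this work.
--  * k never occurs free in a suspension: a variable x contains no k and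
--    λk.C binds it.  Hence substitution leaves every suspension, suspension
--    combination and CPS-value unchanged, and so σ and φ do not see it.
--  * Substituting K for k in a continuation K' composes the two:
--    plugging M into K'[k:=K] is plugging K'[M] into K.
-- The theorem follows by a case split on C: its head (a CPS-value, a
-- suspension or a suspension combination) is invariant by the first fact,
-- and its continuation is handled by the second.

open import Defs
open import Data.Nat using (suc)
open import Algebra.Bundles using (Ring)
open import Relation.Binary.PropositionalEquality
  using (_≡_; refl; cong; cong₂; module ≡-Reasoning)

module _ {a} {A : Set a} where
  open ≡-Reasoning

  -- k is not free in a base suspension, so σ is blind to substitution.
  sigma-substS : (S : Susp A) (K : Cont A) → sigma (substS S K) ≡ sigma S
  sigma-substS (var x)  K = refl
  sigma-substS (lamk C) K = refl

  sigmaT-substT : (T : SComb A) (K : Cont A) → sigmaT (substT T K) ≡ sigmaT T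
  sigmaT-substT (sus S)    K = sigma-substS S K
  sigmaT-substT zer        K = refl
  sigmaT-substT (smul α T) K = cong (smul α) (sigmaT-substT T K)
  sigmaT-substT (add T U)  K = cong₂ add (sigmaT-substT T K) (sigmaT-substT U K)

  phi-substB : (B : CVal A) (K : Cont A) → phi (substB B K) ≡ phi B
  phi-substB (lamx S) K = cong lam (sigma-substS S (renK suc K))

  plug-substK : (K' K : Cont A) (M : Term A)
              → plug (substK K' K) M ≡ plug K (plug K' M)
  plug-substK k          K M = refl
  plug-substK (lamb S K') K M = begin
    plug (substK K' K) (app M (sigma (substS S K))) ≡⟨ cong (λ N → plug (substK K' K) (app M N)) (sigma-substS S K) ⟩
    plug (substK K' K) (app M (sigma S))            ≡⟨ plug-substK K' K (app M (sigma S)) ⟩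
    plug K (plug K' (app M (sigma S)))              ∎

  plug-invC : (K : Cont A) (C : BComp A) → plug K (invC C) ≡ invC (substC C K)
  plug-invC K (kB K' B) = begin
    plug K (plug K' (phi B))               ≡⟨ plug-substK K' K (phi B) ⟨
    plug (substK K' K) (phi B)             ≡⟨ cong (plug (substK K' K)) (phi-substB B K) ⟨
    plug (substK K' K) (phi (substB B K))  ∎
  plug-invC K (bSK B S K') = begin
    plug K (plug K' (app (phi B) (sigma S)))
      ≡⟨ plug-substK K' K (app (phi B) (sigma S)) ⟨
    plug (substK K' K) (app (phi B) (sigma S))
      ≡⟨ cong₂ (λ M N → plug (substK K' K) (app M N)) (phi-substB B K) (sigma-substS S K) ⟨
    plug (substK K' K) (app (phi (substB B K)) (sigma (substS S K)))
      ∎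
  plug-invC K (tK T K') = begin
    plug K (plug K' (sigmaT T))                ≡⟨ plug-substK K' K (sigmaT T) ⟨
    plug (substK K' K) (sigmaT T)              ≡⟨ cong (plug (substK K' K)) (sigmaT-substT T K) ⟨
    plug (substK K' K) (sigmaT (substT T K))   ∎

lemma4p10 : ∀ {c ℓ} (R : Ring c ℓ) (K : Cont (Ring.Carrier R)) (C : BComp (Ring.Carrier R))
            → plug K (invC C) ≡ invC (substC C K)
lemma4p10 R = plug-invC
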